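{- Let $L$ be a normal modal logic with the finite model property. An arrow $f$ of $L\mathbf{KFr}_{lf}$ is an epimorphism if and only if it is surjective, and it is a regular monomorphism if and only if it is injective. Moreover, the coregular factorization of $f$ in $L\mathbf{KFr}_{lf}$ is an epi/regular mono factorization (namely $W\to\mathrm{Im} f\hookrightarrow V$).
   Context: A Kripke frame is a set with a binary relation $\prec$; it is locally finite if each point reaches only finitely many points by finite $\prec$-paths. A p-morphism $f:W\to V$ satisfies: $w\prec w'\Rightarrow f(w)\prec f(w')$, and $f(w)\prec v'\Rightarrow\exists w'(w\prec w'\wedge f(w')=v')$. $L\mathbf{KFr}_{lf}$ is the category of locally finite Kripke frames validating $L$ (i.e. whose powerset modal algebra, with $\Diamond X$ = points having a successor in $X$, is an $L$-algebra) and p-morphisms; it is complete and cocomplete. The coregular factorization of $f:A\to B$ is $f=m\circ e$ where $\iota_0,\iota_1:B\to U$ is the cokernel pair of $f$, $m:E\to B$ is the equalizer of $\iota_0,\iota_1$, and $e:A\to E$ is the induced arrow. -}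

module Defs where

open import Level using (Level; 0ℓ) renaming (suc to lsuc)
open import Data.Nat using (ℕ)
open import Data.Fin using (Fin)
open import Data.Empty using (⊥)
open import Data.Product using (Σ; ∃; _×_; _,_; proj₁)
open import Data.Sum using (_⊎_)
open import Data.List using (List)
open import Data.List.Membership.Propositional using (_∈_)
open import Relation.Nullary using (¬_)
open import Relation.Binary.PropositionalEquality using (_≡_)
open import Relation.Binary.Construct.Closure.ReflexiveTransitive using (Star)
open import Function.Bundles using (_↔_)

infixr 5 _⇒_
data Form : Set where
  var  : ℕ → Form
  ⊥'   : Form
  _⇒_  : Form → Form → Form
  ◇    : Form → Form

¬'_ : Form → Form
¬' φ = φ ⇒ ⊥'

_∨'_ : Form → Form → Form
φ ∨' ψ = (¬' φ) ⇒ ψ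

subst : (ℕ → Form) → Form → Form
subst σ (var n) = σ n
subst σ ⊥' = ⊥'
subst σ (φ ⇒ ψ) = subst σ φ ⇒ subst σ ψ
subst σ (◇ φ) = ◇ (subst σ φ)

record NormalLogic (L : Form → Set) : Set where
  field
    ax1  : ∀ φ ψ → L (φ ⇒ (ψ ⇒ φ))
    ax2  : ∀ φ ψ χ → L ((φ ⇒ (ψ ⇒ χ)) ⇒ ((φ ⇒ ψ) ⇒ (φ ⇒ χ)))
    ax3  : ∀ φ → L ((¬' (¬' φ)) ⇒ φ)
    dia⊥ : L (¬' (◇ ⊥'))
    dia∨ : ∀ φ ψ → L (◇ (φ ∨' ψ) ⇒ (◇ φ ∨' ◇ ψ))
    mp   : ∀ φ ψ → L φ → L (φ ⇒ ψ) → L ψ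
    mon  : ∀ φ ψ → L (φ ⇒ ψ) → L (◇ φ ⇒ ◇ ψ)
    sub  : ∀ σ φ → L φ → L (subst σ φ)

record Frame : Set₁ where
  field
    Carrier : Set
    _≺_     : Carrier → Carrier → Set
open Frame public

-- subsets of W are predicates W → Set; ◇X = points with a successor in X
Sem : (F : Frame) → (ℕ → Carrier F → Set) → Form → Carrier F → Set
Sem F V (var n) w = V n w
Sem F V ⊥' w = ⊥
Sem F V (φ ⇒ ψ) w = Sem F V φ w → Sem F V ψ w
Sem F V (◇ φ) w = Σ (Carrier F) λ w' → _≺_ F w w' × Sem F V φ w'

-- φ holds in the powerset algebra of F: evaluates to the top element
Valid : Frame → Form → Set₁
Valid F φ = ∀ (V : ℕ → Carrier F → Set) w → Sem F V φ w

Validates : (Form → Set) → Frame → Set₁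
Validates L F = ∀ φ → L φ → Valid F φ

LocallyFinite : Frame → Set
LocallyFinite F = ∀ w → Σ (List (Carrier F)) λ xs →
  ∀ w' → Star (_≺_ F) w w' → w' ∈ xs

FiniteFrame : Frame → Set
FiniteFrame F = Σ ℕ λ n → Carrier F ↔ Fin n

FMP : (Form → Set) → Set₁
FMP L = ∀ φ → ¬ L φ →
  Σ Frame λ F → FiniteFrame F × Validates L F × ¬ Valid F φ

record LFrame (L : Form → Set) : Set₁ where
  field
    frame    : Frame
    locFin   : LocallyFinite frame
    validate : Validates L frame
open LFrame public

Pt : {L : Form → Set} → LFrame L → Set
Pt A = Carrier (frame A)

Rel : {L : Form → Set} (A : LFrame L) → Pt A → Pt A → Set
Rel A = _≺_ (frame A)

record Hom {L : Form → Set} (A B : LFrame L) : Set where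
  field
    fun   : Pt A → Pt B
    forth : ∀ {w w'} → Rel A w w' → Rel B (fun w) (fun w')
    back  : ∀ {w v'} → Rel B (fun w) v' → Σ (Pt A) λ w' → Rel A w w' × fun w' ≡ v'
open Hom public

module _ {L : Form → Set} where

  _≈_ : {A B : LFrame L} → Hom A B → Hom A B → Set
  f ≈ g = ∀ x → fun f x ≡ fun g x

  _∘_ : {A B C : LFrame L} → Hom B C → Hom A B → Hom A C
  g ∘ f = record
    { fun   = λ x → fun g (fun f x)
    ; forth = λ r → forth g (forth f r)
    ; back  = λ {w} r → let (b , rb , eb) = back g r
                            (a , ra , ea) = back f rb
                        in a , ra , helper ea eb }
    where
      helper : ∀ {x y z} → fun f x ≡ y → fun g y ≡ z → fun g (fun f x) ≡ z
      helper _≡_.refl _≡_.refl = _≡_.refl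

  Surjective : {A B : LFrame L} → Hom A B → Set
  Surjective f = ∀ b → Σ _ λ a → fun f a ≡ b

  Injective : {A B : LFrame L} → Hom A B → Set
  Injective f = ∀ a a' → fun f a ≡ fun f a' → a ≡ a'

  Epi : {A B : LFrame L} → Hom A B → Set₁
  Epi {A} {B} f = ∀ (U : LFrame L) (g h : Hom B U) → (g ∘ f) ≈ (h ∘ f) → g ≈ h

  IsEqualizer : {E B U : LFrame L} → Hom E B → Hom B U → Hom B U → Set₁
  IsEqualizer {E} {B} m g h =
    ((g ∘ m) ≈ (h ∘ m)) ×
    (∀ (X : LFrame L) (k : Hom X B) → (g ∘ k) ≈ (h ∘ k) →
       Σ (Hom X E) λ u → ((m ∘ u) ≈ k) ×
         (∀ (u' : Hom X E) → (m ∘ u') ≈ k → u' ≈ u))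

  RegularMono : {E B : LFrame L} → Hom E B → Set₁
  RegularMono {E} {B} m =
    Σ (LFrame L) λ U → Σ (Hom B U) λ g → Σ (Hom B U) λ h → IsEqualizer m g h

  IsCokernelPair : {A B U : LFrame L} → Hom A B → Hom B U → Hom B U → Set₁
  IsCokernelPair {A} {B} {U} f ι₀ ι₁ =
    ((ι₀ ∘ f) ≈ (ι₁ ∘ f)) ×
    (∀ (X : LFrame L) (a b : Hom B X) → (a ∘ f) ≈ (b ∘ f) →
       Σ (Hom U X) λ u → ((u ∘ ι₀) ≈ a) × ((u ∘ ι₁) ≈ b) ×
         (∀ (u' : Hom U X) → (u' ∘ ι₀) ≈ a → (u' ∘ ι₁) ≈ b → u' ≈ u))

{-# OPTIONS --safe #-}
-- Surjective arrows are epi, and an injective arrow is the equalizer of any pair that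
-- agrees exactly on its image. The image of f : A → B is an upward-closed subset S of B;
-- gluing two copies of B along S gives a frame with two arrows ι₀, ι₁ from B that agree
-- exactly on S, and that frame validates L because it is covered by the p-morphic images
-- ι₀ B and ι₁ B. Hence an epi is surjective, an injective arrow is the equalizer of ι₀, ι₁,
-- and the cokernel pair of any f agrees only on the image of f. A regular mono m is
-- injective: the image of m, a generated subframe, is equalized by the same pair, so the
-- corestriction of m has a left inverse. In the coregular factorization f = m ∘ e the
-- equalizer m is therefore injective with the same image as f, so e is surjective.
--
-- Excluded middle is used only to decide membership in the image.
module Submission where

open import Defs hiding (subst)
open import Level using (0ℓ; lift; lower) renaming (suc to lsuc)
open import Axiom.ExcludedMiddle using (ExcludedMiddle)
open import Data.Bool using (Bool; true; false; T; not)
open import Data.Bool.Properties using (T-irrelevant)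
open import Data.Empty using (⊥; ⊥-elim)
open import Data.List using (List; []; _∷_; concatMap)
open import Data.List.Membership.Propositional using (_∈_)
open import Data.List.Membership.Propositional.Properties using (∈-concatMap⁺)
open import Data.List.Relation.Unary.Any as Any using (here; there)
open import Data.Nat using (ℕ)
open import Data.Product using (Σ; _×_; _,_; proj₁; proj₂)
open import Data.Sum using (_⊎_; inj₁; inj₂; [_,_]′)
open import Data.Unit using (⊤; tt)
open import Function using (const)
open import Function.Bundles using (_⇔_; mk⇔; module Equivalence)
open import Function.Construct.Identity using (⇔-id)
open import Function.Related.TypeIsomorphisms using (→-cong-⇔)
open import Relation.Binary.Core using (_=[_]⇒_)
open import Relation.Binary.Construct.Closure.ReflexiveTransitive using (gmap)
open import Relation.Binary.PropositionalEquality
  using (_≡_; refl; sym; trans; cong; subst; subst₂; module ≡-Reasoning)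
open import Relation.Nullary using (Dec; ¬_)
open import Relation.Nullary.Decidable using (map′; isYes; toWitness; fromWitness)

open Equivalence using (to; from)

T⇒¬T-not : ∀ {b} → T b → ¬ T (not b)
T⇒¬T-not {true} _ ()

decide : ExcludedMiddle (lsuc 0ℓ) → (P : Set) → Dec P
decide em P = map′ lower lift em

record IsPMorphism (F G : Frame) (p : Carrier F → Carrier G) : Set where
  field
    forth : _≺_ F =[ p ]⇒ _≺_ G
    back  : ∀ {w v'} → _≺_ G (p w) v' → Σ (Carrier F) λ w' → _≺_ F w w' × p w' ≡ v'

module _ {F G : Frame} {p : Carrier F → Carrier G} (p-mor : IsPMorphism F G p) where
  open IsPMorphism p-mor renaming (forth to p-forth; back to p-back)

  sem-preserved : {V : ℕ → Carrier G → Set} {V' : ℕ → Carrier F → Set} →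
                  (∀ n w → V' n w ⇔ V n (p w)) →
                  ∀ φ w → Sem F V' φ w ⇔ Sem G V φ (p w)
  sem-preserved V'⇔V (var n) w = V'⇔V n w
  sem-preserved V'⇔V ⊥' w = ⇔-id ⊥
  sem-preserved V'⇔V (φ ⇒ ψ) w =
    →-cong-⇔ (sem-preserved V'⇔V φ w) (sem-preserved V'⇔V ψ w)
  sem-preserved {V} {V'} V'⇔V (◇ φ) w = mk⇔ preserve reflect
    where
    preserve : Sem F V' (◇ φ) w → Sem G V (◇ φ) (p w)
    preserve (w' , r , s) = p w' , p-forth r , to (sem-preserved V'⇔V φ w') s
    reflect : Sem G V (◇ φ) (p w) → Sem F V' (◇ φ) w
    reflect (_ , r , s) with p-back r
    ... | w' , r' , refl = w' , r' , from (sem-preserved V'⇔V φ w') s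

  valid-on-image : ∀ {φ} → Valid F φ → ∀ V w → Sem G V φ (p w)
  valid-on-image {φ} valid V w = to (sem-preserved (λ _ _ → ⇔-id _) φ w) (valid _ w)

  valid-reflected : (∀ {w w'} → p w ≡ p w' → w ≡ w') → ∀ {φ} → Valid G φ → Valid F φ
  valid-reflected injective {φ} valid V' w = from (sem-preserved V'⇔V φ w) (valid V (p w))
    where
    V : ℕ → Carrier G → Set
    V n v = Σ (Carrier F) λ w → p w ≡ v × V' n w
    V'⇔V : ∀ n w → V' n w ⇔ V n (p w)
    V'⇔V n w = mk⇔ (λ x → w , refl , x) (λ (_ , e , x) → subst (V' n) (injective e) x)

locallyFinite-reflected : {F G : Frame} (p : Carrier G → Carrier F) →
  _≺_ G =[ p ]⇒ _≺_ F →
  (fibre : Carrier F → List (Carrier G)) → (∀ u → u ∈ fibre (p u)) →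
  LocallyFinite F → LocallyFinite G
locallyFinite-reflected p monotone fibre ∈fibre locFinF u with locFinF (p u)
... | reachable , reaches =
  concatMap fibre reachable ,
  λ u' path → ∈-concatMap⁺ fibre (Any.map (λ { refl → ∈fibre u' })
                                           (reaches (p u') (gmap p monotone path)))

module _ {L : Form → Set} where

  mkHom : {A B : LFrame L} {p : Pt A → Pt B} → IsPMorphism (frame A) (frame B) p → Hom A B
  mkHom {p = p} p-mor =
    record { fun = p ; forth = IsPMorphism.forth p-mor ; back = IsPMorphism.back p-mor }

  idHom : {A : LFrame L} → Hom A A
  idHom = record { fun = λ x → x ; forth = λ r → r ; back = λ {_} {v'} r → v' , r , refl }

  surjective⇒epi : {A B : LFrame L} (f : Hom A B) → Surjective f → Epi f
  surjective⇒epi f surj U g h g∘f≈h∘f y with surj y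
  ... | x , refl = g∘f≈h∘f x

  equalizer-mono : {E B U X : LFrame L} {m : Hom E B} {g h : Hom B U} →
                   IsEqualizer m g h → (x y : Hom X E) → (m ∘ x) ≈ (m ∘ y) → x ≈ y
  equalizer-mono {X = X} {m} (g∘m≈h∘m , universal) x y m∘x≈m∘y w
    with universal X (m ∘ y) (λ v → g∘m≈h∘m (fun y v))
  ... | _ , _ , unique = trans (unique x m∘x≈m∘y w) (sym (unique y (λ _ → refl) w))

  factor-through-injective : {A B X : LFrame L} (f : Hom A B) → Injective f → (k : Hom X B) →
    (∀ x → Σ (Pt A) λ a → fun f a ≡ fun k x) → Σ (Hom X A) λ u → (f ∘ u) ≈ k
  factor-through-injective {A} {B} {X} f injective k preimage = u , (λ x → proj₂ (preimage x))
    where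
    u₀ : Pt X → Pt A
    u₀ x = proj₁ (preimage x)
    f∘u₀≡k : ∀ x → fun f (u₀ x) ≡ fun k x
    f∘u₀≡k x = proj₂ (preimage x)
    u-forth : ∀ {x x'} → Rel X x x' → Rel A (u₀ x) (u₀ x')
    u-forth {x} {x'} r with back f (subst₂ (Rel B) (sym (f∘u₀≡k x)) (sym (f∘u₀≡k x')) (forth k r))
    ... | a , r' , fa≡ = subst (Rel A (u₀ x)) (injective a (u₀ x') fa≡) r'
    u-back : ∀ {x a} → Rel A (u₀ x) a → Σ (Pt X) λ x' → Rel X x x' × u₀ x' ≡ a
    u-back {x} {a} r with back k (subst (λ b → Rel B b (fun f a)) (f∘u₀≡k x) (forth f r))
    ... | x' , r' , kx'≡fa = x' , r' , injective (u₀ x') a (trans (f∘u₀≡k x') kx'≡fa)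
    u : Hom X A
    u = record { fun = u₀ ; forth = u-forth ; back = u-back }

  -- Membership is Boolean so that the proofs of membership (T b) are irrelevant: the
  -- subframe and gluing constructions below use them as second components of points.
  record UpSet (B : LFrame L) : Set where
    field
      member    : Pt B → Bool
      up-closed : ∀ {y y'} → T (member y) → Rel B y y' → T (member y')

    member? : ∀ y → T (member y) ⊎ T (not (member y))
    member? y with member y
    ... | true  = inj₁ tt
    ... | false = inj₂ tt

  module Subframe {B : LFrame L} (S : UpSet B) where
    open UpSet S

    Point : Set
    Point = Σ (Pt B) λ y → T (member y)

    subframe : Frame
    subframe = record { Carrier = Point ; _≺_ = λ u v → Rel B (proj₁ u) (proj₁ v) }

    inclusion-isPMorphism : IsPMorphism subframe (frame B) proj₁
    inclusion-isPMorphism = record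
      { forth = λ r → r
      ; back  = λ { {y , i} {y'} r → (y' , up-closed i r) , r , refl } }

    proj₁-injective : ∀ {u v : Point} → proj₁ u ≡ proj₁ v → u ≡ v
    proj₁-injective {y , i} {_ , i'} refl = cong (y ,_) (T-irrelevant i i')

    fibre : Pt B → List Point
    fibre y = [ (λ i → (y , i) ∷ []) , const [] ]′ (member? y)

    ∈fibre : ∀ u → u ∈ fibre (proj₁ u)
    ∈fibre (y , i) with member? y
    ... | inj₁ i' = here (cong (y ,_) (T-irrelevant i i'))
    ... | inj₂ o  = ⊥-elim (T⇒¬T-not i o)

    generated : LFrame L
    generated = record
      { frame    = subframe
      ; locFin   = locallyFinite-reflected proj₁ (λ r → r) fibre ∈fibre (locFin B)
      ; validate = λ φ Lφ →
          valid-reflected inclusion-isPMorphism proj₁-injective {φ} (validate B φ Lφ) }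

    inclusion : Hom generated B
    inclusion = mkHom inclusion-isPMorphism

    inclusion-injective : Injective inclusion
    inclusion-injective _ _ = proj₁-injective

  -- Two copies of B with the points of S identified: the copy inj₁ is all of B, the copy
  -- inj₂ only the points outside S, and from inj₂ one may step into inj₁ exactly inside S.
  module Glued {B : LFrame L} (S : UpSet B) where
    open UpSet S

    Point : Set
    Point = Pt B ⊎ Σ (Pt B) λ y → T (not (member y))

    π : Point → Pt B
    π (inj₁ y)       = y
    π (inj₂ (y , _)) = y

    Allowed : Point → Point → Set
    Allowed (inj₁ _) (inj₁ _)  = ⊤
    Allowed (inj₁ _) (inj₂ _)  = ⊥
    Allowed (inj₂ _) (inj₁ y') = T (member y')
    Allowed (inj₂ _) (inj₂ _)  = ⊤

    glued : Frame
    glued = record { Carrier = Point ; _≺_ = λ u v → Rel B (π u) (π v) × Allowed u v }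

    ι₀′ : Pt B → Point
    ι₀′ = inj₁

    ι₁′ : Pt B → Point
    ι₁′ y = [ const (inj₁ y) , (λ o → inj₂ (y , o)) ]′ (member? y)

    ι₁-inside : ∀ {y} → T (member y) → ι₁′ y ≡ ι₀′ y
    ι₁-inside {y} i with member? y
    ... | inj₁ _ = refl
    ... | inj₂ o = ⊥-elim (T⇒¬T-not i o)

    ι₁-outside : ∀ {y} (o : T (not (member y))) → ι₁′ y ≡ inj₂ (y , o)
    ι₁-outside {y} o with member? y
    ... | inj₁ i  = ⊥-elim (T⇒¬T-not i o)
    ... | inj₂ o' = cong (λ o → inj₂ (y , o)) (T-irrelevant o' o)

    ι₀≡ι₁⇒member : ∀ {y} → ι₀′ y ≡ ι₁′ y → T (member y)
    ι₀≡ι₁⇒member {y} eq with member? y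
    ... | inj₁ i = i

    ι₀-isPMorphism : IsPMorphism (frame B) glued ι₀′
    ι₀-isPMorphism = record { forth = λ r → r , tt ; back = back₀ }
      where
      back₀ : ∀ {y v} → _≺_ glued (inj₁ y) v → Σ (Pt B) λ y' → Rel B y y' × inj₁ y' ≡ v
      back₀ {v = inj₁ y'} (r , _) = y' , r , refl

    ι₁-isPMorphism : IsPMorphism (frame B) glued ι₁′
    ι₁-isPMorphism = record { forth = forth₁ ; back = back₁ }
      where
      forth₁ : ∀ {y y'} → Rel B y y' → _≺_ glued (ι₁′ y) (ι₁′ y')
      forth₁ {y} {y'} r with member? y | member? y'
      ... | inj₁ _ | inj₁ _  = r , tt
      ... | inj₁ i | inj₂ o' = ⊥-elim (T⇒¬T-not (up-closed i r) o')
      ... | inj₂ _ | inj₁ i' = r , i'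
      ... | inj₂ _ | inj₂ _  = r , tt
      back₁ : ∀ {y v} → _≺_ glued (ι₁′ y) v → Σ (Pt B) λ y' → Rel B y y' × ι₁′ y' ≡ v
      back₁ {y} {v} r with member? y
      back₁ {y} {inj₁ y'}       (r , _)  | inj₁ i = y' , r , ι₁-inside (up-closed i r)
      back₁ {y} {inj₁ y'}       (r , i') | inj₂ _ = y' , r , ι₁-inside i'
      back₁ {y} {inj₂ (y' , o)} (r , _)  | inj₂ _ = y' , r , ι₁-outside o

    covered : ∀ u → (Σ (Pt B) λ y → ι₀′ y ≡ u) ⊎ (Σ (Pt B) λ y → ι₁′ y ≡ u)
    covered (inj₁ y)       = inj₁ (y , refl)
    covered (inj₂ (y , o)) = inj₂ (y , ι₁-outside o)

    fibre : Pt B → List Point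
    fibre y = inj₁ y ∷ [ const [] , (λ o → inj₂ (y , o) ∷ []) ]′ (member? y)

    ∈fibre : ∀ u → u ∈ fibre (π u)
    ∈fibre (inj₁ y) = here refl
    ∈fibre (inj₂ (y , o)) with member? y
    ... | inj₁ i  = ⊥-elim (T⇒¬T-not i o)
    ... | inj₂ o' = there (here (cong (λ o → inj₂ (y , o)) (T-irrelevant o o')))

    glued-validates : Validates L glued
    glued-validates φ Lφ V u with covered u
    ... | inj₁ (y , refl) = valid-on-image ι₀-isPMorphism {φ} (validate B φ Lφ) V y
    ... | inj₂ (y , refl) = valid-on-image ι₁-isPMorphism {φ} (validate B φ Lφ) V y

    gluing : LFrame L
    gluing = record
      { frame    = glued
      ; locFin   = locallyFinite-reflected π proj₁ fibre ∈fibre (locFin B)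
      ; validate = glued-validates }

    ι₀ ι₁ : Hom B gluing
    ι₀ = mkHom ι₀-isPMorphism
    ι₁ = mkHom ι₁-isPMorphism

  Im : {A B : LFrame L} → Hom A B → Pt B → Set
  Im {A} f y = Σ (Pt A) λ x → fun f x ≡ y

  Im-up-closed : {A B : LFrame L} (f : Hom A B) → ∀ {y y'} → Im f y → Rel B y y' → Im f y'
  Im-up-closed f (x , refl) r with back f r
  ... | x' , _ , fx'≡y' = x' , fx'≡y'

  module _ (em : ExcludedMiddle (lsuc 0ℓ)) where

    image : {A B : LFrame L} → Hom A B → UpSet B
    image f = record
      { member    = λ y → isYes (decide em (Im f y))
      ; up-closed = λ i r → fromWitness (Im-up-closed f (toWitness i) r) }

    module _ {A B : LFrame L} (f : Hom A B) where
      open Glued (image f)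

      ι₀∘f≈ι₁∘f : (ι₀ ∘ f) ≈ (ι₁ ∘ f)
      ι₀∘f≈ι₁∘f x = sym (ι₁-inside (fromWitness (x , refl)))

      ι₀≡ι₁⇒Im : ∀ y → fun ι₀ y ≡ fun ι₁ y → Im f y
      ι₀≡ι₁⇒Im y eq = toWitness (ι₀≡ι₁⇒member eq)

      cokernelPair-agree⇒Im : {U : LFrame L} (κ₀ κ₁ : Hom B U) → IsCokernelPair f κ₀ κ₁ →
                               ∀ y → fun κ₀ y ≡ fun κ₁ y → Im f y
      cokernelPair-agree⇒Im _ _ (_ , universal) y κ₀y≡κ₁y with universal gluing ι₀ ι₁ ι₀∘f≈ι₁∘f
      ... | c , c∘κ₀≈ι₀ , c∘κ₁≈ι₁ , _ =
        ι₀≡ι₁⇒Im y (trans (sym (c∘κ₀≈ι₀ y)) (trans (cong (fun c) κ₀y≡κ₁y) (c∘κ₁≈ι₁ y)))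

      epi⇒surjective : Epi f → Surjective f
      epi⇒surjective epi y = ι₀≡ι₁⇒Im y (epi gluing ι₀ ι₁ ι₀∘f≈ι₁∘f y)

      injective⇒regularMono : Injective f → RegularMono f
      injective⇒regularMono injective = gluing , ι₀ , ι₁ , ι₀∘f≈ι₁∘f , universal
        where
        universal : ∀ (X : LFrame L) (k : Hom X B) → (ι₀ ∘ k) ≈ (ι₁ ∘ k) →
          Σ (Hom X A) λ u → ((f ∘ u) ≈ k) × (∀ (u' : Hom X A) → (f ∘ u') ≈ k → u' ≈ u)
        universal X k ι₀∘k≈ι₁∘k with factor-through-injective f injective k
                                       (λ x → ι₀≡ι₁⇒Im (fun k x) (ι₀∘k≈ι₁∘k x))
        ... | u , f∘u≈k =
          u , f∘u≈k , λ u' f∘u'≈k x → injective _ _ (trans (f∘u'≈k x) (sym (f∘u≈k x)))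

    regularMono⇒injective : {E B : LFrame L} (m : Hom E B) → RegularMono m → Injective m
    regularMono⇒injective {E} m (U , g , h , equalizer@(g∘m≈h∘m , universal)) a a' ma≡ma' =
      begin
        a                ≡⟨ sym (u∘v≈id a) ⟩
        fun u (fun v a)  ≡⟨ cong (fun u) va≡va' ⟩
        fun u (fun v a') ≡⟨ u∘v≈id a' ⟩
        a'
      ∎
      where
      open Subframe (image m)
      open ≡-Reasoning

      g∘incl≈h∘incl : (g ∘ inclusion) ≈ (h ∘ inclusion)
      g∘incl≈h∘incl (_ , i) with toWitness i
      ... | x , refl = g∘m≈h∘m x

      comparison : Σ (Hom generated E) λ u → (m ∘ u) ≈ inclusion
      comparison with universal generated inclusion g∘incl≈h∘incl
      ... | u , m∘u≈incl , _ = u , m∘u≈incl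

      u : Hom generated E
      u = proj₁ comparison

      corestriction : Σ (Hom E generated) λ v → (inclusion ∘ v) ≈ m
      corestriction = factor-through-injective inclusion inclusion-injective m
                        (λ x → (fun m x , fromWitness (x , refl)) , refl)

      v : Hom E generated
      v = proj₁ corestriction

      u∘v≈id : (u ∘ v) ≈ idHom
      u∘v≈id = equalizer-mono {m = m} {g} {h} equalizer (u ∘ v) idHom λ x →
        trans (proj₂ comparison (fun v x)) (proj₂ corestriction x)

      va≡va' : fun v a ≡ fun v a'
      va≡va' = inclusion-injective _ _
        (trans (proj₂ corestriction a) (trans ma≡ma' (sym (proj₂ corestriction a'))))

    coregular-surjective : {A B : LFrame L} (f : Hom A B) →
      (U : LFrame L) (κ₀ κ₁ : Hom B U) → IsCokernelPair f κ₀ κ₁ →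
      (E : LFrame L) (m : Hom E B) → IsEqualizer m κ₀ κ₁ →
      (e : Hom A E) → (m ∘ e) ≈ f → Surjective e
    coregular-surjective f U κ₀ κ₁ cokernelPair E m equalizer e m∘e≈f x
      with cokernelPair-agree⇒Im f κ₀ κ₁ cokernelPair (fun m x) (proj₁ equalizer x)
    ... | a , fa≡mx =
      a , regularMono⇒injective m (U , κ₀ , κ₁ , equalizer) _ _ (trans (m∘e≈f a) fa≡mx)

proposition5p1 : ExcludedMiddle (lsuc 0ℓ) →
    (L : Form → Set) → NormalLogic L → FMP L →
    {A B : LFrame L} (f : Hom A B) →
      (Epi f ⇔ Surjective f) ×
      (RegularMono f ⇔ Injective f) ×
      (∀ (U : LFrame L) (ι₀ ι₁ : Hom B U) → IsCokernelPair f ι₀ ι₁ →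
       ∀ (E : LFrame L) (m : Hom E B) → IsEqualizer m ι₀ ι₁ →
       ∀ (e : Hom A E) → (m ∘ e) ≈ f →
         Epi e × RegularMono m × Surjective e × Injective m)
proposition5p1 em L _ _ f =
  mk⇔ (epi⇒surjective em f) (surjective⇒epi f) ,
  mk⇔ (regularMono⇒injective em f) (injective⇒regularMono em f) ,
  λ U ι₀ ι₁ cokernelPair E m equalizer e m∘e≈f →
    let m-regular    = U , ι₀ , ι₁ , equalizer
        e-surjective = coregular-surjective em f U ι₀ ι₁ cokernelPair E m equalizer e m∘e≈f
    in surjective⇒epi e e-surjective , m-regular , e-surjective ,
       regularMono⇒injective em m m-regular
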